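{- For every integer $m\ge 0$ and every $n$, there is an injection from $Q_2(m,n)$ to $P_2(-m,n)$.
   Context: Partitions: $\ell(\mu)$ is the number of parts, $\mu_i=0$ if $\mu$ has fewer than $i$ parts, rank of $\lambda$ is $\lambda_1-\ell(\lambda)$. The rank-set of $\lambda=(\lambda_1\ge\cdots\ge\lambda_\ell>0)$ is $[-\lambda_1,1-\lambda_2,\ldots,\ell-1-\lambda_\ell,\ell,\ell+1,\ldots]$. Fix $m\ge0$. The $m$-Durfee rectangle of $\lambda$ is the largest rectangle with $m+j$ rows and $j$ columns inside the Ferrers diagram (so $j$ is the largest integer with $j=0$ or $\lambda_{m+j}\ge j$). The $m$-Durfee rectangle symbol is $(\alpha,\beta)_{(m+j)\times j}$ with $\alpha_i=\lambda'_{j+i}$ (column lengths to the right of the rectangle, $\lambda'$ the conjugate) and $\beta=(\lambda_{m+j+1},\lambda_{m+j+2},\ldots)$ (rows below the rectangle); partitions are identified with their symbols. $Q(m,n)$ is the set of partitions of $n$ with $m$ in the rank-set; $P(-m,n)$ the set of partitions of $n$ with rank $\ge -m$. $Q_2(m,n)$ is the set of $\lambda\in Q(m,n)$ whose symbol $(\alpha,\beta)_{(m+j)\times j}$ satisfies $j\ge1$, $\ell(\beta)\ge\ell(\alpha)$ and $\alpha_1<m+j$. $P_2(-m,n)$ is the set of $\mu\in P(-m,n)$ whose symbol $(\gamma,\delta)_{(m+j')\times j'}$ satisfies $j'\ge1$ and $\delta_1=j'-1$. -}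

module Defs where

open import Data.Nat using (ℕ; zero; suc; _+_; _≤_; _<_; _≥_; _≤?_)
open import Data.Integer as ℤ using (ℤ; +_; -_)
open import Data.List using (List; []; _∷_; length; filter; map; upTo; drop)
open import Data.Nat.ListAction using (sum)
open import Data.List.Relation.Unary.All using (All)
open import Data.List.Relation.Unary.Linked using (Linked)
open import Data.Product using (Σ; _×_; ∃-syntax)
open import Data.Sum using (_⊎_)
open import Relation.Binary.PropositionalEquality using (_≡_)

IsPartition : List ℕ → Set
IsPartition l = All (λ x → 0 < x) l × Linked _≥_ l

IsPartitionOf : ℕ → List ℕ → Set
IsPartitionOf n l = IsPartition l × sum l ≡ n

-- 0-indexed access with default 0:  λ_i (1-indexed) = at λ (i - 1); λ_i = 0 beyond ℓ(λ).
at : List ℕ → ℕ → ℕ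
at []       _       = 0
at (x ∷ xs) zero    = x
at (x ∷ xs) (suc i) = at xs i

conjPart : List ℕ → ℕ → ℕ
conjPart l k = length (filter (λ x → k ≤? x) l)

conj : List ℕ → List ℕ
conj l = map (λ i → conjPart l (suc i)) (upTo (at l 0))

rank : List ℕ → ℤ
rank l = + at l 0 ℤ.- + length l

InRankSet : ℤ → List ℕ → Set
InRankSet r l =
  (∃[ i ] (i < length l × (+ i ℤ.- + at l i) ≡ r))
  ⊎ (∃[ k ] (length l ≤ k × r ≡ + k))

-- j admissible for the m-Durfee rectangle: j = 0 or λ_{m+j} ≥ j
DurfeeAdm : ℕ → List ℕ → ℕ → Set
DurfeeAdm m l j = j ≡ 0 ⊎ (∃[ k ] (j ≡ suc k × suc k ≤ at l (m + k)))

IsDurfee : ℕ → List ℕ → ℕ → Set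
IsDurfee m l j = DurfeeAdm m l j × (∀ j′ → DurfeeAdm m l j′ → j′ ≤ j)

symα : ℕ → List ℕ → List ℕ
symα j l = drop j (conj l)

symβ : ℕ → ℕ → List ℕ → List ℕ
symβ m j l = drop (m + j) l

InQ : ℕ → ℕ → List ℕ → Set
InQ m n l = IsPartitionOf n l × InRankSet (+ m) l

InP : ℕ → ℕ → List ℕ → Set
InP m n l = IsPartitionOf n l × (- (+ m)) ℤ.≤ rank l

InQ₂ : ℕ → ℕ → List ℕ → Set
InQ₂ m n l = InQ m n l ×
  (∃[ j ] (IsDurfee m l j × 1 ≤ j
          × length (symα j l) ≤ length (symβ m j l)
          × at (symα j l) 0 < m + j))

InP₂ : ℕ → ℕ → List ℕ → Set
InP₂ m n l = InP m n l ×
  (∃[ j′ ] (IsDurfee m l j′ × 1 ≤ j′ × suc (at (symβ m j′ l) 0) ≡ j′))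

Q₂ : ℕ → ℕ → Set
Q₂ m n = Σ (List ℕ) (InQ₂ m n)

P₂ : ℕ → ℕ → Set
P₂ m n = Σ (List ℕ) (InP₂ m n)

-- Let λ ∈ Q₂(m,n) have m-Durfee side j = k + 1.  The bound α₁ < m + j forces
-- λ_{m+j} = j, and m ∈ rank-set then forces λ_{m+j+1} = j as well, so
-- λ = t ++ j ∷ β with ℓ(t) = m + k and β = j ∷ β′.  The injection deletes the row
-- λ_{m+j} together with the first column of β and puts these j + ℓ(β) cells in a
-- new first row, which ℓ(β) ≥ ℓ(α) makes the longest.  The result has rank ≥ -m,
-- m-Durfee side j and δ₁ = j - 1, and λ is recovered from it and j, since ℓ(β)
-- is read off its first row.
module Submission where

open import Defs
open import Data.Nat using (ℕ; zero; suc; _+_; _∸_; _≤_; _<_; _≥_; _≤?_; z≤n; s≤s; pred)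
open import Data.Nat.Properties
open import Data.Nat.Tactic.RingSolver using (solve-∀)
open import Data.Integer as ℤ using (+_; -_)
import Data.Integer.Properties as ℤ
import Data.Integer.Tactic.RingSolver as ℤ-Solver
open import Data.List using (List; []; _∷_; length; map; upTo; applyUpTo; take; drop; _++_)
open import Data.List.Properties using (length-++; length-drop; length-map; length-upTo)
open import Data.Nat.ListAction using (sum)
open import Data.Nat.ListAction.Properties using (sum-++)
open import Data.List.Relation.Unary.All as All using (All; []; _∷_)
open import Data.List.Relation.Unary.All.Properties using (++⁺; ++⁻ˡ; ++⁻ʳ)
open import Data.List.Relation.Unary.Linked using (Linked; []; [-]; _∷_; tail)
open import Data.List.Relation.Unary.Linked.Properties using (Linked⇒All)
open import Data.Product using (Σ; _×_; _,_; proj₁; ∃₂)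
open import Data.Sum using (inj₁; inj₂)
open import Relation.Nullary using (contradiction; yes; no)
open import Relation.Nullary.Decidable using (dec-true)
open import Relation.Binary.PropositionalEquality

Decreasing : List ℕ → Set
Decreasing = Linked _≥_

Positive : List ℕ → Set
Positive = All (0 <_)

at-head : ∀ {x xs} → Decreasing (x ∷ xs) → at xs 0 ≤ x
at-head [-]       = z≤n
at-head (x≥y ∷ _) = x≥y

∷-decreasing : ∀ {x xs} → at xs 0 ≤ x → Decreasing xs → Decreasing (x ∷ xs)
∷-decreasing {xs = []}    _   _ = [-]
∷-decreasing {xs = _ ∷ _} y≤x d = y≤x ∷ d

++-decreasingʳ : ∀ t {ys} → Decreasing (t ++ ys) → Decreasing ys
++-decreasingʳ []      d = d
++-decreasingʳ (_ ∷ t) d = ++-decreasingʳ t (tail d)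

at-antitone : ∀ {l} → Decreasing l → ∀ {i j} → i ≤ j → at l j ≤ at l i
at-antitone {[]}    _ _                   = z≤n
at-antitone {_ ∷ _} d {j = zero}  z≤n     = ≤-refl
at-antitone {_ ∷ _} d {j = suc j} z≤n     = ≤-trans (at-antitone (tail d) (z≤n {j})) (at-head d)
at-antitone {_ ∷ _} d (s≤s i≤j)           = at-antitone (tail d) i≤j

at<length : ∀ l {i} → 0 < at l i → i < length l
at<length (_ ∷ _) {zero}  _   = s≤s z≤n
at<length (_ ∷ l) {suc i} pos = s≤s (at<length l pos)

at-++ˡ : ∀ t {xs ys} i → i < length t → at (t ++ xs) i ≡ at (t ++ ys) i
at-++ˡ (_ ∷ _) zero    _         = refl
at-++ˡ (_ ∷ t) (suc i) (s≤s i<t) = at-++ˡ t i i<t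

at-++-length : ∀ t {ys} → at (t ++ ys) (length t) ≡ at ys 0
at-++-length []      = refl
at-++-length (_ ∷ t) = at-++-length t

at-drop : ∀ j xs → at (drop j xs) 0 ≡ at xs j
at-drop zero    _        = refl
at-drop (suc j) []       = refl
at-drop (suc j) (_ ∷ xs) = at-drop j xs

at-map : ∀ (f : ℕ → ℕ) xs i → i < length xs → at (map f xs) i ≡ f (at xs i)
at-map f (_ ∷ _)  zero    _         = refl
at-map f (_ ∷ xs) (suc i) (s≤s i<n) = at-map f xs i i<n

at-applyUpTo : ∀ (f : ℕ → ℕ) n i → i < n → at (applyUpTo f n) i ≡ f i
at-applyUpTo f (suc n) zero    _         = refl
at-applyUpTo f (suc n) (suc i) (s≤s i<n) = at-applyUpTo (λ x → f (suc x)) n i i<n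

take-++-length : ∀ t {ys : List ℕ} → take (length t) (t ++ ys) ≡ t
take-++-length []      = refl
take-++-length (x ∷ t) = cong (x ∷_) (take-++-length t)

drop-++-length : ∀ t {ys : List ℕ} → drop (length t) (t ++ ys) ≡ ys
drop-++-length []      = refl
drop-++-length (_ ∷ t) = drop-++-length t

drop-++-∷ : ∀ t {x} {ys : List ℕ} → drop (suc (length t)) (t ++ x ∷ ys) ≡ ys
drop-++-∷ []      = refl
drop-++-∷ (_ ∷ t) = drop-++-∷ t

length-conj : ∀ l → length (conj l) ≡ at l 0
length-conj l = trans (length-map _ (upTo (at l 0))) (length-upTo (at l 0))

at-conj : ∀ l {i} → i < at l 0 → at (conj l) i ≡ conjPart l (suc i)
at-conj l {i} i<λ₁ = trans
  (at-map _ (upTo (at l 0)) i (subst (i <_) (sym (length-upTo (at l 0))) i<λ₁))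
  (cong (λ x → conjPart l (suc x)) (at-applyUpTo (λ x → x) (at l 0) i i<λ₁))

conjPart-≥ : ∀ {l} → Decreasing l → ∀ {x} i → suc x ≤ at l i → suc i ≤ conjPart l (suc x)
conjPart-≥ {[]}    _ i ()
conjPart-≥ {y ∷ _} d {x} zero x<y
  rewrite dec-true (suc x ≤? y) x<y = s≤s z≤n
conjPart-≥ {y ∷ _} d {x} (suc i) x<λᵢ
  rewrite dec-true (suc x ≤? y) (≤-trans x<λᵢ (at-antitone d {j = suc i} z≤n)) =
  s≤s (conjPart-≥ (tail d) i x<λᵢ)

admissible⇒row : ∀ {m l k} → DurfeeAdm m l (suc k) → suc k ≤ at l (m + k)
admissible⇒row (inj₂ (_ , refl , row)) = row

IsDurfee-unique : ∀ {m l i j} → IsDurfee m l i → IsDurfee m l j → i ≡ j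
IsDurfee-unique (admᵢ , maxᵢ) (admⱼ , maxⱼ) = ≤-antisym (maxⱼ _ admᵢ) (maxᵢ _ admⱼ)

durfee-row-below : ∀ {m l j} → IsDurfee m l j → at l (m + j) ≤ j
durfee-row-below {m} {l} {j} (_ , maximal) with at l (m + j) ≤? j
... | yes row≤j = row≤j
... | no  row≰j = contradiction (maximal (suc j) (inj₂ (j , refl , ≰⇒> row≰j))) 1+n≰n

durfee-at-jump : ∀ {m l k} → Decreasing l →
  suc k ≤ at l (m + k) → at l (m + suc k) ≤ k → IsDurfee m l (suc k)
durfee-at-jump {m} {l} {k} d rowₖ row₊ = inj₂ (k , refl , rowₖ) , maximal
  where
  maximal : ∀ j → DurfeeAdm m l j → j ≤ suc k
  maximal .0 (inj₁ refl) = z≤n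
  maximal .(suc i) (inj₂ (i , refl , rowᵢ)) with i ≤? k
  ... | yes i≤k = s≤s i≤k
  ... | no  i≰k = contradiction
    (≤-trans (n≤1+n i) (≤-trans rowᵢ (≤-trans (at-antitone d (+-monoʳ-≤ m (≰⇒> i≰k))) row₊)))
    i≰k

+i-+a≡+m⇒i≡m+a : ∀ {i a m} → + i ℤ.- + a ≡ + m → i ≡ m + a
+i-+a≡+m⇒i≡m+a {i} {a} i-a≡m = ℤ.+-injective (trans (x≡x-y+y (+ i) (+ a)) (cong (ℤ._+ + a) i-a≡m))
  where
  x≡x-y+y : ∀ x y → x ≡ (x ℤ.- y) ℤ.+ y
  x≡x-y+y = ℤ-Solver.solve-∀

-- With j = suc k: if λ_{m+j} ≥ j ≥ λ_{m+j+1}, the only entry i - λ_{i+1} of the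
-- rank-set that can equal m is the one at i = m + j.
rankSet-row : ∀ {m l k} → Decreasing l → suc k ≤ at l (m + k) → at l (m + suc k) ≤ suc k →
  InRankSet (+ m) l → at l (m + suc k) ≡ suc k
rankSet-row {m} {l} {k} _ rowₖ _ (inj₂ (i , length≤i , m≡i)) =
  contradiction
    (≤-trans (at<length l (≤-trans (s≤s z≤n) rowₖ))
             (subst (length l ≤_) (sym (ℤ.+-injective m≡i)) length≤i))
    (m+n≮m m k)
rankSet-row {m} {l} {k} d rowₖ row₊ (inj₁ (i , _ , i-λᵢ≡m)) = pinned (+i-+a≡+m⇒i≡m+a i-λᵢ≡m)
  where
  pinned : i ≡ m + at l i → at l (m + suc k) ≡ suc k
  pinned i≡m+λᵢ with m + suc k ≤? i
  ... | no  i≱m+j = contradiction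
    (begin m + suc k  ≤⟨ +-monoʳ-≤ m (≤-trans rowₖ (at-antitone d i≤m+k)) ⟩
           m + at l i ≡⟨ sym i≡m+λᵢ ⟩
           i          ∎)
    i≱m+j
    where
    open ≤-Reasoning
    i≤m+k : i ≤ m + k
    i≤m+k = m<1+n⇒m≤n (subst (i <_) (+-suc m k) (≰⇒> i≱m+j))
  ... | yes m+j≤i = begin
    at l (m + suc k) ≡⟨ cong (at l) (sym i≡m+j) ⟩
    at l i           ≡⟨ +-cancelˡ-≡ m _ _ (trans (sym i≡m+λᵢ) i≡m+j) ⟩
    suc k            ∎
    where
    open ≡-Reasoning
    i≡m+j : i ≡ m + suc k
    i≡m+j = ≤-antisym
      (≤-trans (≤-reflexive i≡m+λᵢ) (+-monoʳ-≤ m (≤-trans (at-antitone d m+j≤i) row₊)))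
      m+j≤i

α-row : ∀ {m l k} → Decreasing l → suc k ≤ at l (m + k) →
  at (symα (suc k) l) 0 < m + suc k → at l (m + k) ≡ suc k
α-row {m} {l} {k} d rowₖ α₁<m+j with at l (m + k) ≤? suc k
... | yes row≤j = ≤-antisym row≤j rowₖ
... | no  row≰j = contradiction
  (begin m + suc k                  ≡⟨ +-suc m k ⟩
         suc (m + k)                ≤⟨ conjPart-≥ d (m + k) (≰⇒> row≰j) ⟩
         conjPart l (suc (suc k))   ≡⟨ sym α₁≡λ′ ⟩
         at (symα (suc k) l) 0      ∎)
  (<⇒≱ α₁<m+j)
  where
  open ≤-Reasoning
  α₁≡λ′ : at (symα (suc k) l) 0 ≡ conjPart l (suc (suc k))
  α₁≡λ′ = trans (at-drop (suc k) (conj l))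
                (at-conj l (≤-trans (≰⇒> row≰j) (at-antitone d z≤n)))

split-at-repeat : ∀ l i {c} → at l i ≡ c → at l (suc i) ≡ c → 0 < c →
  ∃₂ λ t β′ → l ≡ t ++ c ∷ c ∷ β′ × length t ≡ i
split-at-repeat []          _       refl _    ()
split-at-repeat (_ ∷ [])    zero    _    refl ()
split-at-repeat (_ ∷ _ ∷ β′) zero    refl refl _ = [] , β′ , refl , refl
split-at-repeat (x ∷ l)     (suc i) λᵢ≡c λᵢ₊₁≡c 0<c with split-at-repeat l i λᵢ≡c λᵢ₊₁≡c 0<c
... | t , β′ , refl , refl = x ∷ t , β′ , refl , refl

-- A member of Q₂(m,n) with m-Durfee side j = suc k: rows m+j and m+j+1 both
-- have length j, and ℓ(α) ≤ ℓ(β) has become a bound on the first row.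
data Shape (m : ℕ) : List ℕ → Set where
  shape : ∀ k t β′ → length t ≡ m + k →
    at (t ++ suc k ∷ suc k ∷ β′) 0 ≤ suc k + suc (length β′) →
    Shape m (t ++ suc k ∷ suc k ∷ β′)

side : ∀ {m l} → Shape m l → ℕ
side (shape k _ _ _ _) = k

m+suc-length : ∀ {m k} (t : List ℕ) → length t ≡ m + k → m + suc k ≡ suc (length t)
m+suc-length {m} {k} _ ℓt≡ = trans (+-suc m k) (cong suc (sym ℓt≡))

shape-from-rows : ∀ {m l k} → at l (m + k) ≡ suc k → at l (m + suc k) ≡ suc k →
  length (symα (suc k) l) ≤ length (symβ m (suc k) l) → Shape m l
shape-from-rows {m} {l} {k} rowₖ row₊ ℓα≤ℓβ
  with split-at-repeat l (m + k) rowₖ (trans (cong (at l) (sym (+-suc m k))) row₊) (s≤s z≤n)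
... | t , β′ , refl , ℓt≡ = shape k t β′ ℓt≡ λ₁≤
  where
  L = t ++ suc k ∷ suc k ∷ β′
  ℓα≡ : length (symα (suc k) L) ≡ at L 0 ∸ suc k
  ℓα≡ = trans (length-drop (suc k) (conj L)) (cong (_∸ suc k) (length-conj L))
  ℓβ≡ : length (symβ m (suc k) L) ≡ suc (length β′)
  ℓβ≡ = cong length (trans (cong (λ i → drop i L) (m+suc-length {m} t ℓt≡)) (drop-++-∷ t))
  λ₁≤ : at L 0 ≤ suc k + suc (length β′)
  λ₁≤ = ≤-trans (m≤n+m∸n (at L 0) (suc k)) (+-monoʳ-≤ (suc k) (subst₂ _≤_ ℓα≡ ℓβ≡ ℓα≤ℓβ))

Q₂⇒Shape : ∀ {m n l} → InQ₂ m n l → Shape m l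
Q₂⇒Shape (_ , zero , _ , () , _)
Q₂⇒Shape {m} {l = l}
  ((((_ , d) , _) , inRankSet) , suc k , durfee@(adm , _) , _ , ℓα≤ℓβ , α₁<m+j) =
  shape-from-rows (α-row d rowₖ α₁<m+j) (rankSet-row d rowₖ rowⱼ₊₁≤j inRankSet) ℓα≤ℓβ
  where
  rowₖ : suc k ≤ at l (m + k)
  rowₖ = admissible⇒row {m} {l} adm
  rowⱼ₊₁≤j : at l (m + suc k) ≤ suc k
  rowⱼ₊₁≤j = durfee-row-below {m} {l} durfee

removeColumn : List ℕ → List ℕ
removeColumn []                 = []
removeColumn (suc (suc x) ∷ xs) = suc x ∷ removeColumn xs
removeColumn (_ ∷ xs)           = removeColumn xs

addColumn : ℕ → List ℕ → List ℕ
addColumn zero    _        = []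
addColumn (suc n) []       = 1 ∷ addColumn n []
addColumn (suc n) (x ∷ xs) = suc x ∷ addColumn n xs

removeColumn-≤1 : ∀ {xs} → All (_≤ 1) xs → removeColumn xs ≡ []
removeColumn-≤1 []                = refl
removeColumn-≤1 (z≤n       ∷ ≤1s) = removeColumn-≤1 ≤1s
removeColumn-≤1 (s≤s z≤n   ∷ ≤1s) = removeColumn-≤1 ≤1s

removeColumn-after-1 : ∀ {xs} → Decreasing (1 ∷ xs) → removeColumn xs ≡ []
removeColumn-after-1 d =
  removeColumn-≤1 (All.tail (Linked⇒All (λ j≤i k≤j → ≤-trans k≤j j≤i) ≤-refl d))

removeColumn-positive : ∀ xs → Positive (removeColumn xs)
removeColumn-positive []                 = []
removeColumn-positive (zero ∷ xs)        = removeColumn-positive xs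
removeColumn-positive (suc zero ∷ xs)    = removeColumn-positive xs
removeColumn-positive (suc (suc _) ∷ xs) = s≤s z≤n ∷ removeColumn-positive xs

length-removeColumn : ∀ xs → length (removeColumn xs) ≤ length xs
length-removeColumn []                 = z≤n
length-removeColumn (zero ∷ xs)        = m≤n⇒m≤1+n (length-removeColumn xs)
length-removeColumn (suc zero ∷ xs)    = m≤n⇒m≤1+n (length-removeColumn xs)
length-removeColumn (suc (suc _) ∷ xs) = s≤s (length-removeColumn xs)

sum-removeColumn : ∀ {xs} → Positive xs → sum (removeColumn xs) + length xs ≡ sum xs
sum-removeColumn {[]} [] = refl
sum-removeColumn {suc zero ∷ xs} (_ ∷ p) =
  trans (+-suc _ (length xs)) (cong suc (sum-removeColumn p))
sum-removeColumn {suc (suc x) ∷ xs} (_ ∷ p) = begin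
  suc x + sum (removeColumn xs) + suc (length xs)
    ≡⟨ +-suc _ (length xs) ⟩
  suc (suc x + sum (removeColumn xs) + length xs)
    ≡⟨ cong suc (+-assoc (suc x) _ _) ⟩
  suc (suc x + (sum (removeColumn xs) + length xs))
    ≡⟨ cong (λ s → suc (suc x + s)) (sum-removeColumn p) ⟩
  suc (suc x + sum xs)
    ∎
  where open ≡-Reasoning

at-removeColumn : ∀ {xs} → Decreasing xs → Positive xs → at (removeColumn xs) 0 ≡ pred (at xs 0)
at-removeColumn {[]}               _ _ = refl
at-removeColumn {zero ∷ _}         _ (() ∷ _)
at-removeColumn {suc zero ∷ _}     d _ rewrite removeColumn-after-1 d = refl
at-removeColumn {suc (suc _) ∷ _}  _ _ = refl

removeColumn-decreasing : ∀ {xs} → Decreasing xs → Positive xs → Decreasing (removeColumn xs)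
removeColumn-decreasing {[]}              _ _ = []
removeColumn-decreasing {zero ∷ _}        _ (() ∷ _)
removeColumn-decreasing {suc zero ∷ _}    d _ rewrite removeColumn-after-1 d = []
removeColumn-decreasing {suc (suc x) ∷ _} d (_ ∷ p) = ∷-decreasing
  (subst (_≤ suc x) (sym (at-removeColumn (tail d) p)) (pred-mono-≤ (at-head d)))
  (removeColumn-decreasing (tail d) p)

addColumn-removeColumn : ∀ {xs} → Decreasing xs → Positive xs →
  addColumn (length xs) (removeColumn xs) ≡ xs
addColumn-removeColumn {[]} _ _ = refl
addColumn-removeColumn {suc zero ∷ xs} d (_ ∷ p) = begin
  addColumn (suc (length xs)) (removeColumn xs)
    ≡⟨ cong (addColumn _) no-column ⟩
  1 ∷ addColumn (length xs) []
    ≡⟨ cong (λ ys → 1 ∷ addColumn (length xs) ys) (sym no-column) ⟩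
  1 ∷ addColumn (length xs) (removeColumn xs)
    ≡⟨ cong (1 ∷_) (addColumn-removeColumn (tail d) p) ⟩
  1 ∷ xs
    ∎
  where
  open ≡-Reasoning
  no-column : removeColumn xs ≡ []
  no-column = removeColumn-after-1 d
addColumn-removeColumn {suc (suc x) ∷ xs} d (_ ∷ p) =
  cong (suc (suc x) ∷_) (addColumn-removeColumn (tail d) p)

++-∷-partitionʳ : ∀ t {x ys} → IsPartition (t ++ x ∷ ys) → IsPartition ys
++-∷-partitionʳ t (p , d) = All.tail (++⁻ʳ t p) , tail (++-decreasingʳ t d)

replace-suffix : ∀ {x} t {c r ys} → Decreasing (x ∷ t ++ c ∷ r) → Decreasing ys → at ys 0 ≤ c →
  Decreasing (x ∷ t ++ ys)
replace-suffix []      d         d′ ys≤c = ∷-decreasing (≤-trans ys≤c (at-head d)) d′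
replace-suffix (_ ∷ t) (x≥y ∷ d) d′ ys≤c = x≥y ∷ replace-suffix t d d′ ys≤c

rank-bound : ∀ {m l} → length l ≤ m + at l 0 → - (+ m) ℤ.≤ rank l
rank-bound {m} {l} ℓ≤ = begin
  - (+ m)                       ≡⟨ -x≡y-[x+y] (+ m) (+ at l 0) ⟩
  + at l 0 ℤ.- + (m + at l 0)   ≤⟨ ℤ.+-monoʳ-≤ (+ at l 0) (ℤ.neg-mono-≤ (ℤ.+≤+ ℓ≤)) ⟩
  + at l 0 ℤ.- + length l       ∎
  where
  open ℤ.≤-Reasoning
  -x≡y-[x+y] : ∀ x y → - x ≡ y ℤ.- (x ℤ.+ y)
  -x≡y-[x+y] = ℤ-Solver.solve-∀

φ : ∀ {m l} → Shape m l → List ℕ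
φ (shape k t β′ _ _) = (suc k + length (suc k ∷ β′)) ∷ t ++ removeColumn (suc k ∷ β′)

ψ : ℕ → ℕ → List ℕ → List ℕ
ψ m k []      = []
ψ m k (h ∷ μ) = take (m + k) μ ++ suc k ∷ addColumn (h ∸ suc k) (drop (m + k) μ)

φ-positive : ∀ {m l} (s : Shape m l) → Positive l → Positive (φ s)
φ-positive (shape k t β′ _ _) p = s≤s z≤n ∷ ++⁺ (++⁻ˡ t p) (removeColumn-positive (suc k ∷ β′))

φ-decreasing : ∀ {m l} (s : Shape m l) → IsPartition l → Decreasing (φ s)
φ-decreasing (shape k t β′ _ λ₁≤) (p , d) =
  replace-suffix t (∷-decreasing λ₁≤ d) (removeColumn-decreasing dβ pβ)
    (subst (_≤ suc k) (sym (at-removeColumn dβ pβ)) (n≤1+n k))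
  where
  open Σ (++-∷-partitionʳ t (p , d)) renaming (proj₁ to pβ; proj₂ to dβ)

φ-row-below : ∀ {m l} (s : Shape m l) → IsPartition l → at (φ s) (m + suc (side s)) ≡ side s
φ-row-below {m} s@(shape k t β′ ℓt≡ _) part = begin
  at (φ s) (m + suc k)                      ≡⟨ cong (at (φ s)) (m+suc-length {m} t ℓt≡) ⟩
  at (t ++ removeColumn β) (length t)       ≡⟨ at-++-length t ⟩
  at (removeColumn β) 0                     ≡⟨ at-removeColumn dβ pβ ⟩
  k                                         ∎
  where
  open ≡-Reasoning
  β = suc k ∷ β′
  open Σ (++-∷-partitionʳ t part) renaming (proj₁ to pβ; proj₂ to dβ)

φ-durfee : ∀ {m l} (s : Shape m l) → IsPartition l → IsDurfee m (φ s) (suc (side s))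
φ-durfee {m} s@(shape k t β′ ℓt≡ λ₁≤) part@(_ , d) =
  durfee-at-jump {m} (φ-decreasing s part) rowₖ (≤-reflexive (φ-row-below s part))
  where
  λ₁+ = suc k + length (suc k ∷ β′)
  L = t ++ suc k ∷ suc k ∷ β′
  open ≤-Reasoning
  rowₖ : suc k ≤ at (φ s) (m + k)
  rowₖ = begin
    suc k                      ≡⟨ sym (at-++-length t) ⟩
    at L (length t)            ≡⟨ cong (at L) ℓt≡ ⟩
    at (λ₁+ ∷ L) (suc (m + k)) ≤⟨ at-antitone (∷-decreasing λ₁≤ d) (n≤1+n (m + k)) ⟩
    at (λ₁+ ∷ L) (m + k)       ≡⟨ at-++ˡ (λ₁+ ∷ t) (m + k) (s≤s (≤-reflexive (sym ℓt≡))) ⟩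
    at (φ s) (m + k)           ∎

sum-φ : ∀ {m l} (s : Shape m l) → Positive l → sum (φ s) ≡ sum l
sum-φ (shape k t β′ _ _) p = begin
  (suc k + length β) + sum (t ++ β⁻)     ≡⟨ cong (_+_ (suc k + length β)) (sum-++ t β⁻) ⟩
  (suc k + length β) + (sum t + sum β⁻)  ≡⟨ rearrange (suc k) (length β) (sum t) (sum β⁻) ⟩
  sum t + (suc k + (sum β⁻ + length β))  ≡⟨ cong (λ x → sum t + (suc k + x)) (sum-removeColumn pβ) ⟩
  sum t + (suc k + sum β)                ≡⟨ sym (sum-++ t (suc k ∷ β)) ⟩
  sum (t ++ suc k ∷ β)                   ∎
  where
  open ≡-Reasoning
  β = suc k ∷ β′
  β⁻ = removeColumn β
  pβ : Positive β
  pβ = All.tail (++⁻ʳ t p)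
  rearrange : ∀ a b c d → (a + b) + (c + d) ≡ c + (a + (d + b))
  rearrange = solve-∀

length-φ : ∀ {m l} (s : Shape m l) → length (φ s) ≤ m + at (φ s) 0
length-φ {m} (shape k t β′ ℓt≡ _) = begin
  suc (length (t ++ removeColumn β))
    ≡⟨ cong suc (length-++ t) ⟩
  suc (length t + length (removeColumn β))
    ≤⟨ s≤s (+-monoʳ-≤ (length t) (length-removeColumn β)) ⟩
  suc (length t + length β)
    ≡⟨ cong (λ x → suc (x + length β)) ℓt≡ ⟩
  suc (m + k + length β)
    ≡⟨ shift m k (length β) ⟩
  m + (suc k + length β)
    ∎
  where
  open ≤-Reasoning
  β = suc k ∷ β′
  shift : ∀ a b c → suc (a + b + c) ≡ a + (suc b + c)
  shift = solve-∀

φ-InP₂ : ∀ {m n l} (s : Shape m l) → IsPartitionOf n l → InP₂ m n (φ s)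
φ-InP₂ {m} s ((p , d) , sum≡n) =
  (((φ-positive s p , φ-decreasing s (p , d)) , trans (sum-φ s p) sum≡n)
  , rank-bound {m} {φ s} (length-φ s))
  , suc (side s) , φ-durfee s (p , d) , s≤s z≤n
  , cong suc (trans (at-drop (m + suc (side s)) (φ s)) (φ-row-below s (p , d)))

ψ-φ : ∀ {m l} (s : Shape m l) → IsPartition l → ψ m (side s) (φ s) ≡ l
ψ-φ {m} (shape k t β′ ℓt≡ _) part = begin
  rebuild (m + k) (suc k + length β ∸ suc k)
    ≡⟨ cong₂ rebuild (sym ℓt≡) (m+n∸m≡n (suc k) (length β)) ⟩
  rebuild (length t) (length β)
    ≡⟨ cong₂ (λ u v → u ++ suc k ∷ addColumn (length β) v) (take-++-length t) (drop-++-length t) ⟩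
  t ++ suc k ∷ addColumn (length β) β⁻
    ≡⟨ cong (λ v → t ++ suc k ∷ v) (addColumn-removeColumn dβ pβ) ⟩
  t ++ suc k ∷ β
    ∎
  where
  open ≡-Reasoning
  β = suc k ∷ β′
  β⁻ = removeColumn β
  open Σ (++-∷-partitionʳ t part) renaming (proj₁ to pβ; proj₂ to dβ)
  rebuild : ℕ → ℕ → List ℕ
  rebuild i h = take i (t ++ β⁻) ++ suc k ∷ addColumn h (drop i (t ++ β⁻))

φ-injective : ∀ {m l l′} (s : Shape m l) (s′ : Shape m l′) → IsPartition l → IsPartition l′ →
  φ s ≡ φ s′ → l ≡ l′
φ-injective {m} {l} {l′} s s′ part part′ φs≡φs′ = begin
  l                    ≡⟨ sym (ψ-φ s part) ⟩
  ψ m (side s) (φ s)   ≡⟨ cong₂ (ψ m) same-side φs≡φs′ ⟩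
  ψ m (side s′) (φ s′) ≡⟨ ψ-φ s′ part′ ⟩
  l′                   ∎
  where
  open ≡-Reasoning
  same-side : side s ≡ side s′
  same-side = suc-injective (IsDurfee-unique {m} {φ s′}
    (subst (λ μ → IsDurfee m μ (suc (side s))) φs≡φs′ (φ-durfee s part)) (φ-durfee s′ part′))

lemma4p1 : (m n : ℕ) →
    Σ (Q₂ m n → P₂ m n) (λ f →
    ∀ x y → proj₁ (f x) ≡ proj₁ (f y) → proj₁ x ≡ proj₁ y)
lemma4p1 m n = Φ , λ (_ , q) (_ , q′) →
  φ-injective (Q₂⇒Shape q) (Q₂⇒Shape q′) (proj₁ (partitionOf q)) (proj₁ (partitionOf q′))
  where
  partitionOf : ∀ {l} → InQ₂ m n l → IsPartitionOf n l
  partitionOf ((part , _) , _) = part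
  Φ : Q₂ m n → P₂ m n
  Φ (_ , q) = φ (Q₂⇒Shape q) , φ-InP₂ (Q₂⇒Shape q) (partitionOf q)
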